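{- Let $G$ and $H$ be graphs on $m$ and $n$ vertices respectively, where either $m\ge 5$ and $n=3$, or $m\ge n\ge 4$. Then $t_2(G\,\square\,H)\ge 2$ and $b_2(G\,\square\,H)\ge 5$.
   Context: Throughout, all graphs are finite and connected. The Cartesian product $G\,\square\,H$ has vertex set $V(G)\times V(H)$, with $(u_1,v_1)$ adjacent to $(u_2,v_2)$ iff either $u_1=u_2$ and $v_1v_2\in E(H)$, or $v_1=v_2$ and $u_1u_2\in E(G)$. The 2-burning process: given a graph $G$ and a sequence $s=(s_1,\dots,s_k)$ of vertices of $G$ (sources), at round $0$ all vertices are uncolored; at each round $j\ge1$, (i) if $j\le k$ and $s_j$ is uncolored, $s_j$ is colored blue, and (ii) every uncolored vertex having at least two neighbors that were blue at the end of round $j-1$ is colored blue. $s$ is a 2-burning sequence if eventually all vertices are blue; $\mathrm{len}(s)=k$ and $\mathrm{rd}(s)$ is the first round at the end of which all vertices are blue. $b_2(G)$ is the minimum of $\mathrm{rd}(s)$ over all 2-burning sequences; a 2-burning sequence achieving it is optimal; $t_2(G)$ is the minimum length of an optimal 2-burning sequence. -}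

module Defs where

open import Data.Nat using (ℕ; zero; suc; _≤_)
open import Data.Fin using (Fin; toℕ)
open import Data.List using (List; length; lookup)
open import Data.Product using (Σ; _×_; _,_; ∃)
open import Data.Sum using (_⊎_)
open import Data.Empty using (⊥)
open import Relation.Nullary using (¬_)
open import Relation.Binary.PropositionalEquality using (_≡_)

record Graph (V : Set) : Set₁ where
  field
    Adj    : V → V → Set
    sym    : ∀ {u v} → Adj u v → Adj v u
    irrefl : ∀ {v} → ¬ Adj v v

open Graph public

data Reach {V : Set} (G : Graph V) : V → V → Set where
  here : ∀ {v} → Reach G v v
  step : ∀ {u v w} → Adj G u v → Reach G v w → Reach G u w

Connected : {V : Set} → Graph V → Set
Connected G = ∀ u v → Reach G u v

_□_ : {V W : Set} → Graph V → Graph W → Graph (V × W)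
Adj (G □ H) (u₁ , v₁) (u₂ , v₂) =
  (u₁ ≡ u₂ × Adj H v₁ v₂) ⊎ (v₁ ≡ v₂ × Adj G u₁ u₂)
sym (G □ H) (Data.Sum.inj₁ (e , a)) = Data.Sum.inj₁ (Relation.Binary.PropositionalEquality.sym e , Graph.sym H a)
sym (G □ H) (Data.Sum.inj₂ (e , a)) = Data.Sum.inj₂ (Relation.Binary.PropositionalEquality.sym e , Graph.sym G a)
irrefl (G □ H) (Data.Sum.inj₁ (_ , a)) = Graph.irrefl H a
irrefl (G □ H) (Data.Sum.inj₂ (_ , a)) = Graph.irrefl G a

-- Source sequences: s = (s_1,…,s_k) is a list; s_{j+1} = lookup s j.
-- IsSource s j v : "the source of round j+1 is v".
IsSource : {V : Set} → List V → ℕ → V → Set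
IsSource s j v = Σ (Fin (length s)) λ i → toℕ i ≡ j × lookup s i ≡ v

Blue : {V : Set} → Graph V → List V → ℕ → V → Set
Blue G s zero v = ⊥
Blue G s (suc j) v =
  Blue G s j v
  ⊎ IsSource s j v
  ⊎ Σ _ λ u → Σ _ λ w → ¬ (u ≡ w) × Adj G v u × Adj G v w
                        × Blue G s j u × Blue G s j w

AllBlue : {V : Set} → Graph V → List V → ℕ → Set
AllBlue G s j = ∀ v → Blue G s j v

IsBurning : {V : Set} → Graph V → List V → Set
IsBurning G s = ∃ λ j → AllBlue G s j

IsRd : {V : Set} → Graph V → List V → ℕ → Set
IsRd G s r = AllBlue G s r × (∀ j → AllBlue G s j → r ≤ j)

IsB2 : {V : Set} → Graph V → ℕ → Set
IsB2 G b = (∃ λ s → IsRd G s b) × (∀ s r → IsRd G s r → b ≤ r)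

Optimal : {V : Set} → Graph V → List V → Set
Optimal G s = Σ ℕ λ b → IsB2 G b × IsRd G s b

IsT2 : {V : Set} → Graph V → ℕ → Set
IsT2 G t = (∃ λ s → Optimal G s × length s ≡ t)
         × (∀ s → Optimal G s → t ≤ length s)

{-# OPTIONS --safe #-}
-- After three rounds only the first three sources and the common neighbours of the first two
-- can be blue. Every neighbour of (x , y) in G □ H shares a coordinate with it, so if the first
-- four sources are (a , b), (c , d), (e , f), (g , h) and x, y avoid suitable coordinates among
-- these, then (x , y) is not the fourth source and at most one of its neighbours is blue after
-- round 3 -- (a , y) if a = c, (x , b) if b = d, (e , f) otherwise -- so it is still uncoloured
-- after round 4. The bounds on m and n are exactly what is needed to choose x and y.
-- A sequence of length at most 1 only ever colours its single source, whence t₂ ≥ 2.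
module Submission where

open import Defs
open import Data.Nat using (ℕ; _≤_)
open import Data.Fin using (Fin)
open import Data.Product using (_×_)
open import Data.Sum using (_⊎_)
open import Relation.Binary.PropositionalEquality using (_≡_)

open import Data.Nat using (zero; suc; _<_; _≤′_; ≤′-refl; ≤′-step; s≤s)
open import Data.Nat.Properties using (≤-refl; ≤-trans; <-≤-trans; <⇒≤; ≰⇒>; ≤⇒≤′; n<1⇒n≡0)
open import Data.Fin using (toℕ) renaming (zero to fzero; suc to fsuc)
open import Data.Fin.Properties using (_≟_; toℕ-injective; toℕ<n; pigeonhole; ¬∀⟶∃¬; <⇒≢)
open import Data.List using (List; []; _∷_; length; lookup)
open import Data.List.Membership.Propositional using (_∈_)
open import Data.List.Relation.Unary.All using (All; []; _∷_)
open import Data.List.Relation.Unary.All.Properties using (¬Any⇒All¬)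
open import Data.List.Relation.Unary.Any using (any?; index)
open import Data.List.Relation.Unary.Any.Properties using (lookup-index)
open import Data.Product using (∃; _,_; proj₁; proj₂; map₂)
open import Data.Sum as Sum using (inj₁; inj₂; [_,_]′)
open import Data.Empty using (⊥-elim)
open import Function using (_∘_)
open import Relation.Nullary using (¬_; yes; no)
open import Relation.Binary.PropositionalEquality as ≡ using (_≢_; refl; trans; cong; cong₂)
open ≡.≡-Reasoning

Avoiding : {A : Set} → List A → Set
Avoiding xs = ∃ λ x → All (x ≢_) xs

fresh : ∀ {k} (xs : List (Fin k)) → length xs < k → Avoiding xs
fresh {k} xs |xs|<k =
  map₂ (¬Any⇒All¬ xs) (¬∀⟶∃¬ k (_∈ xs) (λ x → any? (x ≟_) xs) ¬all∈)
  where
  ¬all∈ : ¬ (∀ x → x ∈ xs)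
  ¬all∈ all∈ with i , j , i<j , same-index ← pigeonhole |xs|<k (index ∘ all∈) =
    <⇒≢ i<j (begin
      i                          ≡⟨ lookup-index (all∈ i) ⟩
      lookup xs (index (all∈ i)) ≡⟨ cong (lookup xs) same-index ⟩
      lookup xs (index (all∈ j)) ≡⟨ ≡.sym (lookup-index (all∈ j)) ⟩
      j                          ∎)

-- sourceOr d s j is the source of round j + 1, or the junk value d once s is exhausted.
sourceOr : {V : Set} → V → List V → ℕ → V
sourceOr d []       _       = d
sourceOr d (x ∷ _)  zero    = x
sourceOr d (_ ∷ xs) (suc j) = sourceOr d xs j

lookup≡sourceOr : {V : Set} (d : V) (s : List V) (i : Fin (length s)) →
                  lookup s i ≡ sourceOr d s (toℕ i)
lookup≡sourceOr d (_ ∷ _) fzero    = refl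
lookup≡sourceOr d (_ ∷ s) (fsuc i) = lookup≡sourceOr d s i

data Round3Cover {V : Set} (_~_ : V → V → Set) (p₁ p₂ p₃ : V) : V → Set where
  first   : Round3Cover _~_ p₁ p₂ p₃ p₁
  second  : Round3Cover _~_ p₁ p₂ p₃ p₂
  third   : Round3Cover _~_ p₁ p₂ p₃ p₃
  between : ∀ {u} → p₁ ≢ p₂ → u ~ p₁ → u ~ p₂ → Round3Cover _~_ p₁ p₂ p₃ u

Round3Cover-map : ∀ {V : Set} {R R′ : V → V → Set} {p₁ p₂ p₃ u : V} →
                  (∀ {v w} → R v w → R′ v w) →
                  Round3Cover R p₁ p₂ p₃ u → Round3Cover R′ p₁ p₂ p₃ u
Round3Cover-map f first               = first
Round3Cover-map f second              = second
Round3Cover-map f third               = third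
Round3Cover-map f (between p₁≢p₂ r r′) = between p₁≢p₂ (f r) (f r′)

module _ {V : Set} (s : List V) where

  IsSource⇒≡sourceOr : ∀ {j v} (d : V) → IsSource s j v → v ≡ sourceOr d s j
  IsSource⇒≡sourceOr d (i , refl , refl) = lookup≡sourceOr d s i

  IsSource-functional : ∀ {j u v} → IsSource s j u → IsSource s j v → u ≡ v
  IsSource-functional (i , refl , refl) (i′ , toℕi′≡toℕi , refl) =
    cong (lookup s) (toℕ-injective (≡.sym toℕi′≡toℕi))

module _ {V : Set} (G : Graph V) (s : List V) where

  Blue-mono′ : ∀ {j k v} → j ≤′ k → Blue G s j v → Blue G s k v
  Blue-mono′ ≤′-refl        blue = blue
  Blue-mono′ (≤′-step j≤′k) blue = inj₁ (Blue-mono′ j≤′k blue)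

  AllBlue-mono : ∀ {j k} → j ≤ k → AllBlue G s j → AllBlue G s k
  AllBlue-mono j≤k allBlue v = Blue-mono′ (≤⇒≤′ j≤k) (allBlue v)

  blue⇒firstSource : ∀ {j v} → length s ≤ 1 → Blue G s j v → IsSource s 0 v
  blue⇒firstSource {suc j} |s|≤1 (inj₁ blue) = blue⇒firstSource |s|≤1 blue
  blue⇒firstSource {suc j} |s|≤1 (inj₂ (inj₁ (i , refl , refl))) =
    i , n<1⇒n≡0 (<-≤-trans (toℕ<n i) |s|≤1) , refl
  blue⇒firstSource {suc j} |s|≤1 (inj₂ (inj₂ (u , w , u≢w , _ , _ , blue-u , blue-w))) =
    ⊥-elim (u≢w (IsSource-functional s (blue⇒firstSource |s|≤1 blue-u)
                                       (blue⇒firstSource |s|≤1 blue-w)))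

  allBlue⇒2≤length : ∀ {j} {u v : V} → u ≢ v → AllBlue G s j → 2 ≤ length s
  allBlue⇒2≤length u≢v allBlue = ≰⇒> λ |s|≤1 →
    u≢v (IsSource-functional s (blue⇒firstSource |s|≤1 (allBlue _))
                             (blue⇒firstSource |s|≤1 (allBlue _)))

  ¬blue-suc : ∀ {j v q} → v ≢ q → ¬ IsSource s j v →
              (∀ {u} → Blue G s j u → u ≡ v ⊎ Adj G v u → u ≡ q) →
              ¬ Blue G s (suc j) v
  ¬blue-suc v≢q _ only-q (inj₁ blue) = v≢q (only-q blue (inj₁ refl))
  ¬blue-suc _ ¬source _ (inj₂ (inj₁ source)) = ¬source source
  ¬blue-suc _ _ only-q (inj₂ (inj₂ (u , w , u≢w , vu , vw , blue-u , blue-w))) =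
    u≢w (trans (only-q blue-u (inj₂ vu)) (≡.sym (only-q blue-w (inj₂ vw))))

  module _ (d : V) where

    private
      p : ℕ → V
      p = sourceOr d s

    blue₁ : ∀ {v} → Blue G s 1 v → v ≡ p 0
    blue₁ (inj₂ (inj₁ source)) = IsSource⇒≡sourceOr s d source

    blue₂ : ∀ {v} → Blue G s 2 v → v ≡ p 0 ⊎ v ≡ p 1
    blue₂ (inj₁ blue)           = inj₁ (blue₁ blue)
    blue₂ (inj₂ (inj₁ source)) = inj₂ (IsSource⇒≡sourceOr s d source)
    blue₂ (inj₂ (inj₂ (_ , _ , u≢w , _ , _ , blue-u , blue-w))) =
      ⊥-elim (u≢w (trans (blue₁ blue-u) (≡.sym (blue₁ blue-w))))

    blue₃ : ∀ {v} → Blue G s 3 v → Round3Cover (Adj G) (p 0) (p 1) (p 2) v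
    blue₃ (inj₁ blue) with blue₂ blue
    ... | inj₁ refl = first
    ... | inj₂ refl = second
    blue₃ (inj₂ (inj₁ source)) with refl ← IsSource⇒≡sourceOr s d source = third
    blue₃ (inj₂ (inj₂ (_ , _ , u≢w , vu , vw , blue-u , blue-w))) with blue₂ blue-u | blue₂ blue-w
    ... | inj₁ refl | inj₁ refl = ⊥-elim (u≢w refl)
    ... | inj₁ refl | inj₂ refl = between u≢w vu vw
    ... | inj₂ refl | inj₁ refl = between (u≢w ∘ ≡.sym) vw vu
    ... | inj₂ refl | inj₂ refl = ⊥-elim (u≢w refl)

Aligned : {A B : Set} → A × B → A × B → Set
Aligned u v = proj₁ u ≡ proj₁ v ⊎ proj₂ u ≡ proj₂ v

□-adj⇒aligned : ∀ {A B} (G : Graph A) (H : Graph B) {u v : A × B} →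
                Adj (G □ H) u v → Aligned u v
□-adj⇒aligned _ _ (inj₁ (u₁≡v₁ , _)) = inj₁ u₁≡v₁
□-adj⇒aligned _ _ (inj₂ (u₂≡v₂ , _)) = inj₂ u₂≡v₂

module _ {A B : Set} where

  -- Evidence that vertex is still uncoloured after round 4 when the sources begin p₁ p₂ p₃ p₄.
  record Survivor (p₁ p₂ p₃ p₄ : A × B) : Set where
    field
      vertex guard   : A × B
      vertex≢guard   : vertex ≢ guard
      vertex≢p₄      : vertex ≢ p₄
      aligned⇒guard : ∀ {u} → Aligned vertex u → Round3Cover Aligned p₁ p₂ p₃ u → u ≡ guard

  round3-sameFst : ∀ {a e : A} {b d f : B} {u} →
                   Round3Cover Aligned (a , b) (a , d) (e , f) u → proj₁ u ≡ a ⊎ u ≡ (e , f)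
  round3-sameFst first                                  = inj₁ refl
  round3-sameFst second                                 = inj₁ refl
  round3-sameFst third                                  = inj₂ refl
  round3-sameFst (between _ (inj₁ u₁≡a) _)              = inj₁ u₁≡a
  round3-sameFst (between _ (inj₂ _) (inj₁ u₁≡a))       = inj₁ u₁≡a
  round3-sameFst (between p₁≢p₂ (inj₂ refl) (inj₂ refl)) = ⊥-elim (p₁≢p₂ refl)

  round3-sameSnd : ∀ {a c e : A} {b f : B} {u} →
                   Round3Cover Aligned (a , b) (c , b) (e , f) u → proj₂ u ≡ b ⊎ u ≡ (e , f)
  round3-sameSnd first                                  = inj₁ refl
  round3-sameSnd second                                 = inj₁ refl
  round3-sameSnd third                                  = inj₂ refl
  round3-sameSnd (between _ (inj₂ u₂≡b) _)              = inj₁ u₂≡b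
  round3-sameSnd (between _ (inj₁ _) (inj₂ u₂≡b))       = inj₁ u₂≡b
  round3-sameSnd (between p₁≢p₂ (inj₁ refl) (inj₁ refl)) = ⊥-elim (p₁≢p₂ refl)

  round3-corners : ∀ {a c e : A} {b d f : B} {u} → a ≢ c → b ≢ d →
                   Round3Cover Aligned (a , b) (c , d) (e , f) u →
                   (proj₁ u ≡ a ⊎ proj₁ u ≡ c) × (proj₂ u ≡ b ⊎ proj₂ u ≡ d) ⊎ u ≡ (e , f)
  round3-corners _ _ first                                   = inj₁ (inj₁ refl , inj₁ refl)
  round3-corners _ _ second                                  = inj₁ (inj₂ refl , inj₂ refl)
  round3-corners _ _ third                                   = inj₂ refl
  round3-corners _ _ (between _ (inj₁ u₁≡a) (inj₂ u₂≡d))     = inj₁ (inj₁ u₁≡a , inj₂ u₂≡d)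
  round3-corners _ _ (between _ (inj₂ u₂≡b) (inj₁ u₁≡c))     = inj₁ (inj₂ u₁≡c , inj₁ u₂≡b)
  round3-corners a≢c _ (between _ (inj₁ refl) (inj₁ u₁≡c))   = ⊥-elim (a≢c u₁≡c)
  round3-corners _ b≢d (between _ (inj₂ refl) (inj₂ u₂≡d))   = ⊥-elim (b≢d u₂≡d)

  survivor-sameFst : ∀ {a e g x : A} {b d f h y : B} →
                     x ≢ a → x ≢ e → x ≢ g → y ≢ f → Survivor (a , b) (a , d) (e , f) (g , h)
  survivor-sameFst {a} {e} {x = x} {y = y} x≢a x≢e x≢g y≢f = record
    { vertex         = x , y
    ; guard          = a , y
    ; vertex≢guard   = x≢a ∘ cong proj₁
    ; vertex≢p₄      = x≢g ∘ cong proj₁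
    ; aligned⇒guard = λ aligned → only-guard aligned ∘ round3-sameFst
    }
    where
    only-guard : ∀ {u} → Aligned (x , y) u → proj₁ u ≡ a ⊎ u ≡ (e , _) → u ≡ (a , y)
    only-guard (inj₁ x≡u₁) (inj₁ u₁≡a) = ⊥-elim (x≢a (trans x≡u₁ u₁≡a))
    only-guard (inj₂ y≡u₂) (inj₁ u₁≡a) = cong₂ _,_ u₁≡a (≡.sym y≡u₂)
    only-guard (inj₁ x≡e)  (inj₂ refl) = ⊥-elim (x≢e x≡e)
    only-guard (inj₂ y≡f)  (inj₂ refl) = ⊥-elim (y≢f y≡f)

  survivor-sameSnd : ∀ {a c e g x : A} {b f h y : B} →
                     x ≢ e → x ≢ g → y ≢ b → y ≢ f → Survivor (a , b) (c , b) (e , f) (g , h)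
  survivor-sameSnd {x = x} {b = b} {f = f} {y = y} x≢e x≢g y≢b y≢f = record
    { vertex         = x , y
    ; guard          = x , b
    ; vertex≢guard   = y≢b ∘ cong proj₂
    ; vertex≢p₄      = x≢g ∘ cong proj₁
    ; aligned⇒guard = λ aligned → only-guard aligned ∘ round3-sameSnd
    }
    where
    only-guard : ∀ {u} → Aligned (x , y) u → proj₂ u ≡ b ⊎ u ≡ (_ , f) → u ≡ (x , b)
    only-guard (inj₁ x≡u₁) (inj₁ u₂≡b) = cong₂ _,_ (≡.sym x≡u₁) u₂≡b
    only-guard (inj₂ y≡u₂) (inj₁ u₂≡b) = ⊥-elim (y≢b (trans y≡u₂ u₂≡b))
    only-guard (inj₁ x≡e)  (inj₂ refl) = ⊥-elim (x≢e x≡e)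
    only-guard (inj₂ y≡f)  (inj₂ refl) = ⊥-elim (y≢f y≡f)

  survivor-corners : ∀ {a c e g x : A} {b d f h y : B} → a ≢ c → b ≢ d →
                     x ≢ a → x ≢ c → x ≢ e → y ≢ b → y ≢ d → (x , y) ≢ (g , h) →
                     Survivor (a , b) (c , d) (e , f) (g , h)
  survivor-corners {a} {c} {e} {x = x} {b = b} {d = d} {f = f} {y = y}
                   a≢c b≢d x≢a x≢c x≢e y≢b y≢d v≢p₄ = record
    { vertex         = x , y
    ; guard          = e , f
    ; vertex≢guard   = x≢e ∘ cong proj₁
    ; vertex≢p₄      = v≢p₄
    ; aligned⇒guard = λ aligned → only-guard aligned ∘ round3-corners a≢c b≢d
    }
    where
    only-guard : ∀ {u} → Aligned (x , y) u →
                 (proj₁ u ≡ a ⊎ proj₁ u ≡ c) × (proj₂ u ≡ b ⊎ proj₂ u ≡ d) ⊎ u ≡ (e , f) →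
                 u ≡ (e , f)
    only-guard _           (inj₂ u≡p₃)               = u≡p₃
    only-guard (inj₁ refl) (inj₁ (inj₁ x≡a , _)) = ⊥-elim (x≢a x≡a)
    only-guard (inj₁ refl) (inj₁ (inj₂ x≡c , _)) = ⊥-elim (x≢c x≡c)
    only-guard (inj₂ refl) (inj₁ (_ , inj₁ y≡b)) = ⊥-elim (y≢b y≡b)
    only-guard (inj₂ refl) (inj₁ (_ , inj₂ y≡d)) = ⊥-elim (y≢d y≡d)

survivor : ∀ {m n} → 4 ≤ m → 3 ≤ n → 5 ≤ m ⊎ 4 ≤ n →
           (p₁ p₂ p₃ p₄ : Fin m × Fin n) → Survivor p₁ p₂ p₃ p₄
survivor m≥4 n≥3 m≥5⊎n≥4 (a , b) (c , d) (e , f) (g , h) with a ≟ c | b ≟ d | m≥5⊎n≥4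
... | yes refl | _ | _
  with x , x≢a ∷ x≢e ∷ x≢g ∷ [] ← fresh (a ∷ e ∷ g ∷ []) m≥4
     | y , y≢f ∷ []             ← fresh (f ∷ []) (<⇒≤ n≥3)
  = survivor-sameFst x≢a x≢e x≢g y≢f
... | no _ | yes refl | _
  with x , x≢e ∷ x≢g ∷ []   ← fresh (e ∷ g ∷ []) (<⇒≤ m≥4)
     | y , y≢b ∷ y≢f ∷ [] ← fresh (b ∷ f ∷ []) n≥3
  = survivor-sameSnd x≢e x≢g y≢b y≢f
... | no a≢c | no b≢d | inj₁ m≥5
  with x , x≢a ∷ x≢c ∷ x≢e ∷ x≢g ∷ [] ← fresh (a ∷ c ∷ e ∷ g ∷ []) m≥5
     | y , y≢b ∷ y≢d ∷ []             ← fresh (b ∷ d ∷ []) n≥3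
  = survivor-corners a≢c b≢d x≢a x≢c x≢e y≢b y≢d (x≢g ∘ cong proj₁)
... | no a≢c | no b≢d | inj₂ n≥4
  with x , x≢a ∷ x≢c ∷ x≢e ∷ []   ← fresh (a ∷ c ∷ e ∷ []) m≥4
     | y , y≢b ∷ y≢d ∷ y≢h ∷ [] ← fresh (b ∷ d ∷ h ∷ []) n≥4
  = survivor-corners a≢c b≢d x≢a x≢c x≢e y≢b y≢d (y≢h ∘ cong proj₂)

module _ {m n} (G : Graph (Fin m)) (H : Graph (Fin n)) where

  ¬allBlue₄ : 4 ≤ m → 3 ≤ n → 5 ≤ m ⊎ 4 ≤ n → ∀ s → ¬ AllBlue (G □ H) s 4
  ¬allBlue₄ m≥4@(s≤s _) n≥3@(s≤s _) m≥5⊎n≥4 s allBlue =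
    ¬blue-suc (G □ H) s vertex≢guard (vertex≢p₄ ∘ IsSource⇒≡sourceOr s d) only-guard
              (allBlue vertex)
    where
    d : Fin m × Fin n
    d = fzero , fzero

    p : ℕ → Fin m × Fin n
    p = sourceOr d s

    open Survivor (survivor m≥4 n≥3 m≥5⊎n≥4 (p 0) (p 1) (p 2) (p 3))

    only-guard : ∀ {u} → Blue (G □ H) s 3 u → u ≡ vertex ⊎ Adj (G □ H) vertex u → u ≡ guard
    only-guard blue near =
      aligned⇒guard (closed-neighbour⇒aligned near)
                    (Round3Cover-map (□-adj⇒aligned G H) (blue₃ (G □ H) s d blue))
      where
      closed-neighbour⇒aligned : ∀ {u} → u ≡ vertex ⊎ Adj (G □ H) vertex u → Aligned vertex u
      closed-neighbour⇒aligned (inj₁ refl) = inj₁ refl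
      closed-neighbour⇒aligned (inj₂ adj)  = □-adj⇒aligned G H adj

  allBlue⇒5≤round : 4 ≤ m → 3 ≤ n → 5 ≤ m ⊎ 4 ≤ n → ∀ s {j} → AllBlue (G □ H) s j → 5 ≤ j
  allBlue⇒5≤round m≥4 n≥3 m≥5⊎n≥4 s allBlue =
    ≰⇒> λ j≤4 → ¬allBlue₄ m≥4 n≥3 m≥5⊎n≥4 s (AllBlue-mono (G □ H) s j≤4 allBlue)

  allBlue⇒2≤length□ : 2 ≤ m → 1 ≤ n → ∀ s {j} → AllBlue (G □ H) s j → 2 ≤ length s
  allBlue⇒2≤length□ (s≤s (s≤s _)) (s≤s _) s =
    allBlue⇒2≤length (G □ H) s {u = fzero , fzero} {v = fsuc fzero , fzero} λ ()

corollary3 : (m n : ℕ) (G : Graph (Fin m)) (H : Graph (Fin n))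
    → Connected G → Connected H
    → ((5 ≤ m × n ≡ 3) ⊎ (4 ≤ n × n ≤ m))
    → (∀ t → IsT2 (G □ H) t → 2 ≤ t) × (∀ b → IsB2 (G □ H) b → 5 ≤ b)
corollary3 m n G H _ _ sizes = t₂≥2 , b₂≥5
  where
  m≥4 : 4 ≤ m
  m≥4 = [ <⇒≤ ∘ proj₁ , (λ (n≥4 , n≤m) → ≤-trans n≥4 n≤m) ]′ sizes
  n≥3 : 3 ≤ n
  n≥3 = [ (λ { (_ , refl) → ≤-refl }) , <⇒≤ ∘ proj₁ ]′ sizes
  m≥5⊎n≥4 : 5 ≤ m ⊎ 4 ≤ n
  m≥5⊎n≥4 = Sum.map proj₁ proj₁ sizes
  t₂≥2 : ∀ t → IsT2 (G □ H) t → 2 ≤ t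
  t₂≥2 _ ((s , (_ , _ , allBlue , _) , refl) , _) =
    allBlue⇒2≤length□ G H (<⇒≤ (<⇒≤ m≥4)) (<⇒≤ (<⇒≤ n≥3)) s allBlue
  b₂≥5 : ∀ b → IsB2 (G □ H) b → 5 ≤ b
  b₂≥5 _ ((s , allBlue , _) , _) = allBlue⇒5≤round G H m≥4 n≥3 m≥5⊎n≥4 s allBlue
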